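{- Let $H=(V,E)$ be a hypergraph with $E\neq\emptyset$, and let $\mathbf{A}=\{A_1,\ldots,A_k\}$ be any partition of $V$. Suppose there exists $H'\in\mathcal{S}(H)$ such that $\mathbf{A}=p(H')$. Then the edge contribution of the strict modularity of $\mathbf{A}$, namely $\frac{1}{|E|}\sum_{i=1}^k e_H(A_i)$, equals $\frac{|E^*|}{|E|}$, where $E^*$ is the edge set of the canonical representative $f([H'])$ of the equivalence class $[H']$.
   Context: A hypergraph $H=(V,E)$ has a finite vertex set $V=\{v_1,\ldots,v_n\}$ and a finite set $E$ of hyperedges, each hyperedge $e$ being a multiset of vertices, described by multiplicities $m_e(v)\in\mathbb{N}\cup\{0\}$, of size $|e|=\sum_v m_e(v)\ge 2$. We write $e\subseteq A$ if every vertex $v$ with $m_e(v)>0$ lies in $A$. For $A\subseteq V$, the strict edge contribution count is $e_H(A)=|\{e\in E: e\subseteq A\}|$. $\mathcal{S}(H)=\{(V,E'): E'\subseteq E\}$ is the set of sub-hypergraphs of $H$ on vertex set $V$. For $H'=(V,E')\in\mathcal{S}(H)$, $p(H')$ is the partition of $V$ into the connected components of $H'$ (two vertices are in the same part iff they are joined by a finite sequence of hyperedges of $E'$ in which consecutive hyperedges share a vertex, the first contains one vertex and the last the other; a vertex in no hyperedge of $E'$ forms a singleton part). Define $H_1\equiv_p H_2$ iff $p(H_1)=p(H_2)$; this is an equivalence relation on $\mathcal{S}(H)$ with classes $[H']$. The canonical representative $f([H'])$ is the member of $[H']$ with the largest number of hyperedges; it exists and is unique, and its edge set is the union of the edge sets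 of all members of $[H']$. -}

module Defs where

open import Data.Nat using (ℕ; zero; suc; _≤_; _<_; _≟_; _<?_; NonZero)
open import Data.Fin using (Fin)
open import Data.Fin.Properties using (all?)
import Data.Fin.Properties as FinP
open import Data.Fin.Subset using (Subset; _∈_; ∣_∣)
open import Data.List using (List; map; length; filter; allFin)
open import Data.Nat.ListAction using (sum)
open import Data.Integer using (+_)
open import Data.Rational using (ℚ; _/_)
open import Data.Product using (Σ; _×_; ∃)
open import Data.Sum using (_⊎_)
open import Function.Bundles using (_⇔_)
open import Function.Definitions using (Surjective)
open import Relation.Binary.PropositionalEquality using (_≡_)
open import Relation.Binary.Construct.Closure.ReflexiveTransitive using (Star)
open import Relation.Nullary using (Dec; ¬_)
open import Relation.Nullary.Decidable using (_→-dec_)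

Σ[_] : ∀ {n} → (Fin n → ℕ) → ℕ
Σ[ f ] = sum (map f (allFin _))

countFin : ∀ {n} {P : Fin n → Set} → ((i : Fin n) → Dec (P i)) → ℕ
countFin P? = length (filter P? (allFin _))

-- A hypergraph on vertex set V = Fin n with m hyperedges (indexed by Fin m);
-- hyperedge e is the multiset given by multiplicities mult e v, of size ≥ 2.
record Hypergraph (n m : ℕ) : Set where
  field
    mult   : Fin m → Fin n → ℕ
    size≥2 : ∀ e → 2 ≤ Σ[ mult e ]
open Hypergraph public

module _ {n m : ℕ} (H : Hypergraph n m) where

  _∈ₑ_ : Fin n → Fin m → Set
  v ∈ₑ e = 0 < mult H e v

  -- A partition of V into k (nonempty) parts A_1..A_k, as a block labelling.
  -- e ⊆ A_i  iff every vertex with positive multiplicity in e lies in A_i.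
  EdgeIn : ∀ {k} → (Fin n → Fin k) → Fin k → Fin m → Set
  EdgeIn c i e = ∀ v → v ∈ₑ e → c v ≡ i

  EdgeIn? : ∀ {k} (c : Fin n → Fin k) (i : Fin k) (e : Fin m) → Dec (EdgeIn c i e)
  EdgeIn? c i e = all? (λ v → (0 <? mult H e v) →-dec (c v FinP.≟ i))

  eH : ∀ {k} → (Fin n → Fin k) → Fin k → ℕ
  eH c i = countFin (EdgeIn? c i)

  edgeContribution : ∀ {k} → (Fin n → Fin k) → .{{NonZero m}} → ℚ
  edgeContribution c = (+ Σ[ eH c ]) / m

  -- Sub-hypergraphs (V, E') of H are given by E' : Subset m.
  -- u and v share a hyperedge of E'
  Adjacent : Subset m → Fin n → Fin n → Set
  Adjacent E' u v = ∃ λ e → e ∈ E' × u ∈ₑ e × v ∈ₑ e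

  Connected : Subset m → Fin n → Fin n → Set
  Connected E' = Star (Adjacent E')

  -- The partition given by block labelling c (into k nonempty parts) equals p(V,E')
  IsComponentPartition : ∀ {k} → (Fin n → Fin k) → Subset m → Set
  IsComponentPartition c E' = Surjective _≡_ _≡_ c × (∀ u v → (c u ≡ c v) ⇔ Connected E' u v)

  _≡ₚ_ : Subset m → Subset m → Set
  E₁ ≡ₚ E₂ = ∀ u v → Connected E₁ u v ⇔ Connected E₂ u v

  -- E* is the edge set of the canonical representative f([H']) of [H'], H' = (V,E'):
  -- the member of the class with the largest number of hyperedges.
  IsCanonicalRep : Subset m → Subset m → Set
  IsCanonicalRep E' E* = (E* ≡ₚ E') × (∀ E'' → E'' ≡ₚ E' → ∣ E'' ∣ ≤ ∣ E* ∣)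

-- Group the sum Σᵢ e_H(Aᵢ) by edges instead of blocks: every hyperedge has a
-- vertex, so it lies inside at most one block, and inside one exactly when it is
-- monochromatic for the partition.  The monochromatic edges form a sub-hypergraph
-- with the same components as H' (the blocks are unions of components), and every
-- edge set with those components is monochromatic; so they are the largest member
-- of [H'], whose size is |E*|.
module Submission where

open import Defs
open import Data.Nat using (ℕ; NonZero; zero; suc; _+_; _<_; z≤n; s≤s; _<?_)
open import Data.Nat.Properties using (≤-antisym; ≤-trans; +-0-commutativeMonoid)
open import Data.Fin using (Fin) renaming (zero to fzero; suc to fsuc)
open import Data.Fin.Properties using (all?; 0≢1+n; suc-injective) renaming (_≟_ to _≟ᶠ_)
open import Data.Fin.Subset using (Subset; ∣_∣; _⊆_) renaming (_∈_ to _∈ₛ_)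
open import Data.Fin.Subset.Properties using (p⊆q⇒∣p∣≤∣q∣)
open import Data.Integer using (+_)
open import Data.Rational using (_/_)
open import Data.Bool using (true)
open import Data.List using (length; filter; tabulate)
import Data.Nat.ListAction as List
open import Data.List.Properties using (map-tabulate)
import Data.Vec as Vec
open import Data.Vec.Properties using (lookup∘tabulate; lookup⇒[]=; []=⇒lookup)
open import Data.Product using (∃; _,_; proj₂)
open import Data.Empty using (⊥-elim)
open import Function using (_∘_; id)
open import Function.Bundles using (_⇔_; Equivalence; mk⇔)
open import Relation.Binary.PropositionalEquality
  using (_≡_; refl; sym; trans; cong; subst; module ≡-Reasoning)
open import Relation.Binary.Construct.Closure.ReflexiveTransitive using (ε; _◅_; gmap)
open import Relation.Nullary using (Dec; yes; no; ¬_; does)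
open import Relation.Nullary.Decidable using (_→-dec_; dec-true)
open import Algebra.Properties.CommutativeMonoid.Sum +-0-commutativeMonoid
  using (sum; sum-cong-≗; ∑-comm)

𝟙 : ∀ {P : Set} → Dec P → ℕ
𝟙 (yes _) = 1
𝟙 (no _)  = 0

does≡true⇒ : ∀ {P : Set} (d : Dec P) → does d ≡ true → P
does≡true⇒ (yes p) _ = p

Σ[]≡sum : ∀ {n} (f : Fin n → ℕ) → Σ[ f ] ≡ sum f
Σ[]≡sum f = trans (cong List.sum (map-tabulate id f)) (sum-tabulate f)
  where
    sum-tabulate : ∀ {n} (f : Fin n → ℕ) → List.sum (tabulate f) ≡ sum f
    sum-tabulate {zero}  f = refl
    sum-tabulate {suc n} f = cong (λ s → f fzero + s) (sum-tabulate (f ∘ fsuc))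

length-filter-tabulate : ∀ {n} {A : Set} {P : A → Set} (P? : ∀ x → Dec (P x)) (g : Fin n → A) →
                         length (filter P? (tabulate g)) ≡ sum (𝟙 ∘ P? ∘ g)
length-filter-tabulate {zero}  P? g = refl
length-filter-tabulate {suc n} P? g with P? (g fzero)
... | yes _ = cong suc (length-filter-tabulate P? (g ∘ fsuc))
... | no _  = length-filter-tabulate P? (g ∘ fsuc)

countFin≡∑𝟙 : ∀ {n} {P : Fin n → Set} (P? : ∀ i → Dec (P i)) → countFin P? ≡ sum (𝟙 ∘ P?)
countFin≡∑𝟙 P? = length-filter-tabulate P? id

∣tabulate-does∣≡∑𝟙 : ∀ {n} {P : Fin n → Set} (P? : ∀ i → Dec (P i)) →
                     ∣ Vec.tabulate (does ∘ P?) ∣ ≡ sum (𝟙 ∘ P?)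
∣tabulate-does∣≡∑𝟙 {zero}  P? = refl
∣tabulate-does∣≡∑𝟙 {suc n} P? with P? fzero
... | yes _ = cong suc (∣tabulate-does∣≡∑𝟙 (P? ∘ fsuc))
... | no _  = ∣tabulate-does∣≡∑𝟙 (P? ∘ fsuc)

∈tabulate⇔ : ∀ {n} {P : Fin n → Set} (P? : ∀ i → Dec (P i)) {i} → i ∈ₛ Vec.tabulate (does ∘ P?) ⇔ P i
∈tabulate⇔ P? {i} = mk⇔
  (λ i∈ → does≡true⇒ (P? i) (trans (sym (lookup∘tabulate (does ∘ P?) i)) ([]=⇒lookup i∈)))
  (λ p → lookup⇒[]= i _ (trans (lookup∘tabulate (does ∘ P?) i) (dec-true (P? i) p)))

∑𝟙-empty : ∀ {n} {P : Fin n → Set} (P? : ∀ i → Dec (P i)) → (∀ i → ¬ P i) → sum (𝟙 ∘ P?) ≡ 0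
∑𝟙-empty {zero}  P? ¬P = refl
∑𝟙-empty {suc n} P? ¬P with P? fzero
... | yes p = ⊥-elim (¬P fzero p)
... | no _  = ∑𝟙-empty (P? ∘ fsuc) (¬P ∘ fsuc)

∑𝟙-unique : ∀ {n} {P : Fin n → Set} (P? : ∀ i → Dec (P i)) (j : Fin n) →
            (∀ i → P i ⇔ i ≡ j) → sum (𝟙 ∘ P?) ≡ 1
∑𝟙-unique P? fzero P⇔ with P? fzero
... | no ¬p = ⊥-elim (¬p (Equivalence.from (P⇔ fzero) refl))
... | yes _ = cong suc (∑𝟙-empty (P? ∘ fsuc) (λ i p → 0≢1+n (sym (Equivalence.to (P⇔ (fsuc i)) p))))
∑𝟙-unique P? (fsuc j) P⇔ with P? fzero
... | yes p = ⊥-elim (0≢1+n (Equivalence.to (P⇔ fzero) p))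
... | no _  = ∑𝟙-unique (P? ∘ fsuc) j (λ i → mk⇔
  (suc-injective ∘ Equivalence.to (P⇔ (fsuc i))) (Equivalence.from (P⇔ (fsuc i)) ∘ cong fsuc))

sum-pos⇒∃pos : ∀ {n} (f : Fin n → ℕ) → 0 < sum f → ∃ λ i → 0 < f i
sum-pos⇒∃pos {suc n} f 0<∑ with f fzero in eq
... | suc _ = fzero , subst (0 <_) (sym eq) (s≤s z≤n)
... | zero with sum-pos⇒∃pos (f ∘ fsuc) 0<∑
...   | i , 0<fi = fsuc i , 0<fi

module _ {n m : ℕ} (H : Hypergraph n m) where

  vertexOf : ∀ e → ∃ λ v → _∈ₑ_ H v e
  vertexOf e = sum-pos⇒∃pos (mult H e) (subst (0 <_) (Σ[]≡sum (mult H e)) (≤-trans (s≤s z≤n) (size≥2 H e)))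

  module _ {k} (c : Fin n → Fin k) where

    Monochromatic : Fin m → Set
    Monochromatic e = ∀ u v → _∈ₑ_ H u e → _∈ₑ_ H v e → c u ≡ c v

    monochromatic? : ∀ e → Dec (Monochromatic e)
    monochromatic? e = all? λ u → all? λ v →
      (0 <? mult H e u) →-dec ((0 <? mult H e v) →-dec (c u ≟ᶠ c v))

    monochromaticEdges : Subset m
    monochromaticEdges = Vec.tabulate (does ∘ monochromatic?)

    edgeIn⇔≡block : ∀ {e v} → Monochromatic e → _∈ₑ_ H v e → ∀ i → EdgeIn H c i e ⇔ i ≡ c v
    edgeIn⇔≡block {e} {v} mono v∈e i = mk⇔
      (λ e⊆Aᵢ → sym (e⊆Aᵢ v v∈e))
      (λ { refl u u∈e → mono u v u∈e v∈e })

    ∑blocksContaining≡𝟙monochromatic : ∀ e → sum (λ i → 𝟙 (EdgeIn? H c i e)) ≡ 𝟙 (monochromatic? e)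
    ∑blocksContaining≡𝟙monochromatic e with vertexOf e | monochromatic? e
    ... | v , v∈e | yes mono = ∑𝟙-unique (λ i → EdgeIn? H c i e) (c v) (edgeIn⇔≡block mono v∈e)
    ... | _       | no ¬mono = ∑𝟙-empty (λ i → EdgeIn? H c i e)
      (λ i e⊆Aᵢ → ¬mono (λ u w u∈e w∈e → trans (e⊆Aᵢ u u∈e) (sym (e⊆Aᵢ w w∈e))))

    Σ[eH]≡∣monochromaticEdges∣ : Σ[ eH H c ] ≡ ∣ monochromaticEdges ∣
    Σ[eH]≡∣monochromaticEdges∣ = begin
      Σ[ eH H c ]                                          ≡⟨ Σ[]≡sum (eH H c) ⟩
      sum (eH H c)                                         ≡⟨ sum-cong-≗ (λ i → countFin≡∑𝟙 (EdgeIn? H c i)) ⟩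
      sum (λ i → sum (λ e → 𝟙 (EdgeIn? H c i e)))          ≡⟨ ∑-comm (λ i e → 𝟙 (EdgeIn? H c i e)) ⟩
      sum (λ e → sum (λ i → 𝟙 (EdgeIn? H c i e)))          ≡⟨ sum-cong-≗ ∑blocksContaining≡𝟙monochromatic ⟩
      sum (𝟙 ∘ monochromatic?)                              ≡⟨ sym (∣tabulate-does∣≡∑𝟙 monochromatic?) ⟩
      ∣ monochromaticEdges ∣                                ∎
      where open ≡-Reasoning

    connected⇒sameBlock : ∀ {u v} → Connected H monochromaticEdges u v → c u ≡ c v
    connected⇒sameBlock ε = refl
    connected⇒sameBlock ((e , e∈ , u∈e , w∈e) ◅ path) =
      trans (Equivalence.to (∈tabulate⇔ monochromatic?) e∈ _ _ u∈e w∈e) (connected⇒sameBlock path)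

    module _ {E' : Subset m} (components : IsComponentPartition H c E') where

      sameComponents⇒⊆monochromaticEdges : ∀ {E''} → _≡ₚ_ H E'' E' → E'' ⊆ monochromaticEdges
      sameComponents⇒⊆monochromaticEdges E''≡ₚE' {e} e∈ = Equivalence.from (∈tabulate⇔ monochromatic?)
        λ u v u∈e v∈e → Equivalence.from (proj₂ components u v)
          (Equivalence.to (E''≡ₚE' u v) ((e , e∈ , u∈e , v∈e) ◅ ε))

      monochromaticEdges≡ₚ : _≡ₚ_ H monochromaticEdges E'
      monochromaticEdges≡ₚ u v = mk⇔
        (Equivalence.to (proj₂ components u v) ∘ connected⇒sameBlock)
        (gmap id λ { (e , e∈ , u∈e , v∈e) →
          e , sameComponents⇒⊆monochromaticEdges (λ _ _ → mk⇔ id id) e∈ , u∈e , v∈e })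

      monochromaticEdges-isCanonicalRep : IsCanonicalRep H E' monochromaticEdges
      monochromaticEdges-isCanonicalRep = monochromaticEdges≡ₚ ,
        λ E'' E''≡ₚE' → p⊆q⇒∣p∣≤∣q∣ (sameComponents⇒⊆monochromaticEdges E''≡ₚE')

  canonicalRep-∣∣-unique : ∀ {E' A B} → IsCanonicalRep H E' A → IsCanonicalRep H E' B → ∣ A ∣ ≡ ∣ B ∣
  canonicalRep-∣∣-unique (A≡ₚE' , A-max) (B≡ₚE' , B-max) = ≤-antisym (B-max _ A≡ₚE') (A-max _ B≡ₚE')

mainTheorem1 : ∀ {n m k} (H : Hypergraph n m) .{{_ : NonZero m}}
    (c : Fin n → Fin k) (E' : Subset m) → IsComponentPartition H c E'
    → (E* : Subset m) → IsCanonicalRep H E' E*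
    → edgeContribution H c ≡ (+ ∣ E* ∣) / m
mainTheorem1 {m = m} H c E' components E* canonical = cong (λ x → (+ x) / m) (begin
  Σ[ eH H c ]                 ≡⟨ Σ[eH]≡∣monochromaticEdges∣ H c ⟩
  ∣ monochromaticEdges H c ∣  ≡⟨ canonicalRep-∣∣-unique H
                                   (monochromaticEdges-isCanonicalRep H c components) canonical ⟩
  ∣ E* ∣                      ∎)
  where open ≡-Reasoning
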